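{- Representative conditional bisimilarity is closed under contextualization: if $(a,b,\mathcal C)\in{\simeq_R}$ with $a,b\colon 0\to J$, then $(a;d,\ b;d,\ \mathcal C_{\downarrow d})\in{\simeq_R}$ for every arrow $d\colon J\to K$.
   Context: Composition of $f\colon A\to B$, $g\colon B\to C$ is written $f;g$. Fix a category $\mathbf C$ with distinguished object $0$ and a representative class $\kappa$ of commuting squares: for every commuting square $\alpha_1;\delta_1=\alpha_2;\delta_2$ there are $(\alpha_1,\alpha_2,\beta_1,\beta_2)\in\kappa$ (a commuting square) and $\gamma$ with $\delta_1=\beta_1;\gamma$, $\delta_2=\beta_2;\gamma$; $\kappa(\alpha_1,\alpha_2)$ is the set of $(\beta_1,\beta_2)$ with $(\alpha_1,\alpha_2,\beta_1,\beta_2)\in\kappa$. Conditions over $A$ are defined inductively as $(A,\mathcal Q,S)$, $\mathcal Q\in\{\forall,\exists\}$, $S$ a finite set of pairs $(h,\mathcal A')$ with $h\colon A\to A'$, $\mathcal A'$ a condition over $A'$. For $a\colon A\to B$: $a\models(A,\forall,S)$ iff for all $(h,\mathcal A')\in S$ and all $g$ with $a=h;g$, $g\models\mathcal A'$; $a\models(A,\exists,S)$ iff some $(h,\mathcal A')\in S$ and $g$ satisfy $a=h;g$, $g\models\mathcal A'$. $\mathcal A\models\mathcal B$: every arrow satisfying $\mathcal A$ satisfies $\mathcal B$. Boolean connectives have the standard semantics. Shift along $c\colon A\to B$: $(A,\mathcal Q,S)_{\downarrow c}=(B,\mathcal Q,\{(\beta,\mathcal A'_{\downarrow\alpha})\mid(h,\mathcal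 A')\in S,(\alpha,\beta)\in\kappa(h,c)\})$; it satisfies $c;d\models\mathcal A\iff d\models\mathcal A_{\downarrow c}$. A conditional reactive system is a set $\mathcal S$ of rules $(\ell,r,\mathcal R)$, $\ell,r\colon0\to I$, $\mathcal R$ a condition over $I$. Context step $a\xrightarrow[C]{f,\ \mathcal A}a'$ ($a\colon0\to J$, $f\colon J\to K$, $a'\colon0\to K$, $\mathcal A$ over $K$): there are a rule $(\ell,r,\mathcal R)\in\mathcal S$ and $c\colon I\to K$ with $a;f=\ell;c$, $a'=r;c$, $\mathcal A\models\mathcal R_{\downarrow c}$. Representative step $a\xrightarrow[R]{f,\ \mathcal A}a'$: a context step where additionally $(f,c)\in\kappa(a,\ell)$ and $\mathcal A=\mathcal R_{\downarrow c}$. A conditional relation is a set of triples $(a,b,\mathcal C)$ with $a,b\colon0\to J$ and $\mathcal C$ a condition over $J$. $\mathcal D\models\bigvee_{i\in I}\mathcal E_i$ (possibly infinite $I$) means every arrow satisfying $\mathcal D$ satisfies some $\mathcal E_i$. A representative conditional bisimulation is a conditional relation $R$ such that for each $(a,b,\mathcal C)\in R$ and each representative step $a\xrightarrow[R]{f,\ \mathcal A}a'$ there are an index set $I$, context steps $b\xrightarrow[C]{f,\ \mathcal B_i}b'_i$ and conditions $\mathcal C'_i$ with $(a',b'_i,\mathcal C'_i)\in R$ and $\mathcal A\land\mathcal C_{\downarrow f}\models\bigvee_{i\in I}(\mathcal C'_i\land\mathcal B_i)$; and symmetrically for representative steps of $b$ answered by context steps of $a$. Representative conditional bisimilarity $\simeq_R$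 is the set of triples contained in some representative conditional bisimulation. -}

module Defs where

open import Level using (Level; _⊔_; suc)
open import Data.Unit.Polymorphic using (⊤)
open import Data.Empty.Polymorphic using (⊥)
open import Data.Product using (Σ; Σ-syntax; ∃; _×_; _,_)
open import Data.Sum using (_⊎_)
open import Data.List using (List; []; _∷_; map; _++_)
open import Data.List.Membership.Propositional using (_∈_)
open import Relation.Binary.PropositionalEquality using (_≡_)

-- Categories (composition written in diagrammatic order  f ; g)

record Category (o h : Level) : Set (suc (o ⊔ h)) where
  infixr 9 _⨾_
  field
    Obj  : Set o
    Hom  : Obj → Obj → Set h
    id   : ∀ {A} → Hom A A
    _⨾_  : ∀ {A B C} → Hom A B → Hom B C → Hom A C
    identityˡ : ∀ {A B} (f : Hom A B) → id ⨾ f ≡ f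
    identityʳ : ∀ {A B} (f : Hom A B) → f ⨾ id ≡ f
    assoc     : ∀ {A B C D} (f : Hom A B) (g : Hom B C) (k : Hom C D) →
                (f ⨾ g) ⨾ k ≡ f ⨾ (g ⨾ k)

data Quant : Set where
  ∀Q ∃Q : Quant

module Conditions {o h : Level} (𝒞 : Category o h) where
  open Category 𝒞

  -- A condition (A, Q, S); S is a finite set (list) of pairs (h , A')
  -- with h : A → A' and A' a condition over A'.
  data Cond (A : Obj) : Set (o ⊔ h) where
    cond : Quant → List (Σ[ A' ∈ Obj ] (Hom A A' × Cond A')) → Cond A

  -- Cospans out of B₁ and B₂ (the second half (β₁,β₂) of a square).
  Cospan : Obj → Obj → Set (o ⊔ h)
  Cospan B₁ B₂ = Σ[ D ∈ Obj ] (Hom B₁ D × Hom B₂ D)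

  mutual
    _⊨_ : ∀ {A B} → Hom A B → Cond A → Set (o ⊔ h)
    a ⊨ cond ∀Q S = ⊨∀ a S
    a ⊨ cond ∃Q S = ⊨∃ a S

    ⊨∀ : ∀ {A B} → Hom A B → List (Σ[ A' ∈ Obj ] (Hom A A' × Cond A')) → Set (o ⊔ h)
    ⊨∀ a [] = ⊤
    ⊨∀ {B = B} a ((A' , k , 𝒜') ∷ S) =
      (∀ (g : Hom A' B) → a ≡ k ⨾ g → g ⊨ 𝒜') × ⊨∀ a S

    ⊨∃ : ∀ {A B} → Hom A B → List (Σ[ A' ∈ Obj ] (Hom A A' × Cond A')) → Set (o ⊔ h)
    ⊨∃ a [] = ⊥
    ⊨∃ {B = B} a ((A' , k , 𝒜') ∷ S) =
      (Σ[ g ∈ Hom A' B ] (a ≡ k ⨾ g × g ⊨ 𝒜')) ⊎ ⊨∃ a S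

  _⊨C_ : ∀ {A} → Cond A → Cond A → Set (o ⊔ h)
  _⊨C_ {A} 𝒜 ℬ = ∀ {B} (x : Hom A B) → x ⊨ 𝒜 → x ⊨ ℬ

-- A representative class κ of commuting squares.  κ α₁ α₂ lists the
-- pairs (β₁ , β₂) with (α₁ , α₂ , β₁ , β₂) ∈ κ (as cospans).

record RepresentativeSquares {o h : Level} (𝒞 : Category o h) : Set (o ⊔ h) where
  open Category 𝒞
  open Conditions 𝒞 using (Cospan)
  field
    κ : ∀ {A B₁ B₂} → Hom A B₁ → Hom A B₂ → List (Cospan B₁ B₂)
    commutes : ∀ {A B₁ B₂ D} {α₁ : Hom A B₁} {α₂ : Hom A B₂}
               {β₁ : Hom B₁ D} {β₂ : Hom B₂ D} →
               (D , β₁ , β₂) ∈ κ α₁ α₂ → α₁ ⨾ β₁ ≡ α₂ ⨾ β₂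
    represents : ∀ {A B₁ B₂ E} (α₁ : Hom A B₁) (α₂ : Hom A B₂)
                 (δ₁ : Hom B₁ E) (δ₂ : Hom B₂ E) → α₁ ⨾ δ₁ ≡ α₂ ⨾ δ₂ →
                 Σ[ D ∈ Obj ] Σ[ β₁ ∈ Hom B₁ D ] Σ[ β₂ ∈ Hom B₂ D ]
                 ((D , β₁ , β₂) ∈ κ α₁ α₂ ×
                  Σ[ γ ∈ Hom D E ] (δ₁ ≡ β₁ ⨾ γ × δ₂ ≡ β₂ ⨾ γ))

record CRS (o h ℓs : Level) : Set (suc (o ⊔ h ⊔ ℓs)) where
  field
    𝒞 : Category o h
  open Category 𝒞 public
  open Conditions 𝒞 public
  field
    𝟎   : Obj
    rep : RepresentativeSquares 𝒞
  open RepresentativeSquares rep public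

  Rule : Set (o ⊔ h)
  Rule = Σ[ I ∈ Obj ] (Hom 𝟎 I × Hom 𝟎 I × Cond I)

  field
    rules : Rule → Set ℓs

module Theory {o h ℓs : Level} (𝒮 : CRS o h ℓs) where
  open CRS 𝒮 public

  mutual
    _↓_ : ∀ {A B} → Cond A → Hom A B → Cond B
    cond Q S ↓ c = cond Q (shiftS S c)

    shiftS : ∀ {A B} → List (Σ[ A' ∈ Obj ] (Hom A A' × Cond A')) → Hom A B →
             List (Σ[ B' ∈ Obj ] (Hom B B' × Cond B'))
    shiftS [] c = []
    shiftS ((A' , k , 𝒜') ∷ S) c =
      map (λ { (D , α , β) → (D , β , (𝒜' ↓ α)) }) (κ k c) ++ shiftS S c

  ContextStep : ∀ {J K} → Hom 𝟎 J → Hom J K → Cond K → Hom 𝟎 K → Set (o ⊔ h ⊔ ℓs)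
  ContextStep {J} {K} a f 𝒜 a' =
    Σ[ I ∈ Obj ] Σ[ ℓ ∈ Hom 𝟎 I ] Σ[ r ∈ Hom 𝟎 I ] Σ[ ℛ ∈ Cond I ]
    (rules (I , ℓ , r , ℛ) × Σ[ c ∈ Hom I K ]
      (a ⨾ f ≡ ℓ ⨾ c × a' ≡ r ⨾ c × 𝒜 ⊨C (ℛ ↓ c)))

  RepStep : ∀ {J K} → Hom 𝟎 J → Hom J K → Cond K → Hom 𝟎 K → Set (o ⊔ h ⊔ ℓs)
  RepStep {J} {K} a f 𝒜 a' =
    Σ[ I ∈ Obj ] Σ[ ℓ ∈ Hom 𝟎 I ] Σ[ r ∈ Hom 𝟎 I ] Σ[ ℛ ∈ Cond I ]
    (rules (I , ℓ , r , ℛ) × Σ[ c ∈ Hom I K ]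
      (a ⨾ f ≡ ℓ ⨾ c × a' ≡ r ⨾ c × 𝒜 ⊨C (ℛ ↓ c) ×
       (K , f , c) ∈ κ a ℓ × 𝒜 ≡ ℛ ↓ c))

  ℓR : Level
  ℓR = o ⊔ h ⊔ ℓs

  CondRel : Set (suc ℓR)
  CondRel = ∀ {J} → Hom 𝟎 J → Hom 𝟎 J → Cond J → Set ℓR

  Answer : CondRel → ∀ {J} → Hom 𝟎 J → Hom 𝟎 J → Cond J → Set (suc ℓR)
  Answer R {J} a b 𝒞₀ =
    ∀ {K} (f : Hom J K) (𝒜 : Cond K) (a' : Hom 𝟎 K) → RepStep a f 𝒜 a' →
    Σ[ Ix ∈ Set ℓR ] Σ[ ℬ ∈ (Ix → Cond K) ] Σ[ b' ∈ (Ix → Hom 𝟎 K) ]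
    Σ[ 𝒞' ∈ (Ix → Cond K) ]
      ((∀ i → ContextStep b f (ℬ i) (b' i)) ×
       (∀ i → R a' (b' i) (𝒞' i)) ×
       (∀ {M} (x : Hom K M) → x ⊨ 𝒜 → x ⊨ (𝒞₀ ↓ f) →
          Σ[ i ∈ Ix ] (x ⊨ 𝒞' i × x ⊨ ℬ i)))

  flipRel : CondRel → CondRel
  flipRel R a b 𝒞₀ = R b a 𝒞₀

  IsRepBisim : CondRel → Set (suc ℓR)
  IsRepBisim R = ∀ {J} (a b : Hom 𝟎 J) (𝒞₀ : Cond J) → R a b 𝒞₀ →
    Answer R a b 𝒞₀ × Answer (flipRel R) b a 𝒞₀

  _≃R_∣_ : ∀ {J} → Hom 𝟎 J → Hom 𝟎 J → Cond J → Set (suc ℓR)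
  a ≃R b ∣ 𝒞₀ = Σ[ R ∈ CondRel ] (IsRepBisim R × R a b 𝒞₀)

module Submission where

-- Idea.  Given a representative bisimulation R, its contextual closure
--   Contextualised R = { (a ⨾ d , b ⨾ d , 𝒞 ↓ d) ∣ (a , b , 𝒞) ∈ R }
-- is again a representative bisimulation.  A representative step of a ⨾ d
-- along f is in particular a context step of a along d ⨾ f; since κ is
-- representative, this square factors through a representative square
-- (f₀ , c₀) ∈ κ a ℓ followed by some γ, i.e. through a representative step
-- of a along f₀.  The answer R provides for that smaller step is then
-- transported back along γ: context steps, related triples and the
-- covering entailment are all stable under extending contexts by γ.

open import Defs
open import Level using (_⊔_)
open import Function using (_∘_; _$_)
open import Function.Bundles using (_⇔_; mk⇔; Equivalence)
open import Data.Product using (Σ-syntax; _,_; _×_)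
open import Data.Sum using (inj₁; inj₂; [_,_])
open import Data.List using (List; []; _∷_; map; _++_)
open import Data.List.Relation.Unary.All as All using (All; []; _∷_)
open import Data.List.Relation.Unary.Any using (Any; here; there)
import Data.List.Relation.Unary.All.Properties as Allₚ
import Data.List.Relation.Unary.Any.Properties as Anyₚ
open import Data.List.Membership.Propositional using (find; lose)
open import Relation.Binary.PropositionalEquality
  using (_≡_; refl; sym; trans; cong; subst; module ≡-Reasoning)

open Equivalence using (to; from)

module ContextualClosure {o h ℓs} (𝒮 : CRS o h ℓs) where
  open Theory 𝒮

  Entry : Obj → Set (o ⊔ h)
  Entry A = Σ[ A' ∈ Obj ] (Hom A A' × Cond A')

  EveryFactorisation : ∀ {A B} → Hom A B → Entry A → Set (o ⊔ h)
  EveryFactorisation {B = B} a (A' , k , 𝒜') = ∀ (g : Hom A' B) → a ≡ k ⨾ g → g ⊨ 𝒜'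

  SomeFactorisation : ∀ {A B} → Hom A B → Entry A → Set (o ⊔ h)
  SomeFactorisation {B = B} a (A' , k , 𝒜') = Σ[ g ∈ Hom A' B ] (a ≡ k ⨾ g × g ⊨ 𝒜')

  ⊨∀⇔All : ∀ {A B} {a : Hom A B} (S : List (Entry A)) → ⊨∀ a S ⇔ All (EveryFactorisation a) S
  ⊨∀⇔All S = mk⇔ (toAll S) (fromAll S)
    where
    toAll : ∀ S → ⊨∀ _ S → All _ S
    toAll []      _       = []
    toAll (e ∷ S) (p , q) = p ∷ toAll S q
    fromAll : ∀ S → All _ S → ⊨∀ _ S
    fromAll []      _        = _
    fromAll (e ∷ S) (p ∷ ps) = p , fromAll S ps

  ⊨∃⇔Any : ∀ {A B} {a : Hom A B} (S : List (Entry A)) → ⊨∃ a S ⇔ Any (SomeFactorisation a) S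
  ⊨∃⇔Any S = mk⇔ (toAny S) (fromAny S)
    where
    toAny : ∀ S → ⊨∃ _ S → Any _ S
    toAny []      ()
    toAny (e ∷ S) (inj₁ p) = here p
    toAny (e ∷ S) (inj₂ q) = there (toAny S q)
    fromAny : ∀ S → Any _ S → ⊨∃ _ S
    fromAny (e ∷ S) (here p)  = inj₁ p
    fromAny (e ∷ S) (there q) = inj₂ (fromAny S q)

  shiftEntry : ∀ {A' B} → Cond A' → Cospan A' B → Entry B
  shiftEntry 𝒜' (D , α , β) = D , β , 𝒜' ↓ α

  paste : ∀ {A A' B D C} {k : Hom A A'} {c : Hom A B} {α : Hom A' D} {β : Hom B D}
    {d : Hom B C} {g : Hom D C} → k ⨾ α ≡ c ⨾ β → d ≡ β ⨾ g → c ⨾ d ≡ k ⨾ (α ⨾ g)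
  paste {k = k} {c} {α} {β} {d} {g} square d≡βg = begin
    c ⨾ d         ≡⟨ cong (c ⨾_) d≡βg ⟩
    c ⨾ (β ⨾ g)   ≡⟨ sym (assoc c β g) ⟩
    (c ⨾ β) ⨾ g   ≡⟨ cong (_⨾ g) (sym square) ⟩
    (k ⨾ α) ⨾ g   ≡⟨ assoc k α g ⟩
    k ⨾ (α ⨾ g)   ∎
    where open ≡-Reasoning

  ShiftProperty : ∀ {A} → Cond A → Set (o ⊔ h)
  ShiftProperty {A} 𝒜 = ∀ {D C} (α : Hom A D) (g : Hom D C) → (α ⨾ g) ⊨ 𝒜 ⇔ g ⊨ (𝒜 ↓ α)

  shiftEntry-every : ∀ {A A' B C} (k : Hom A A') (𝒜' : Cond A') → ShiftProperty 𝒜' →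
    (c : Hom A B) (d : Hom B C) →
    EveryFactorisation (c ⨾ d) (A' , k , 𝒜') ⇔ All (EveryFactorisation d) (map (shiftEntry 𝒜') (κ k c))
  shiftEntry-every k 𝒜' ih c d = mk⇔ forward backward
    where
    forward : EveryFactorisation (c ⨾ d) (_ , k , 𝒜') → All (EveryFactorisation d) (map (shiftEntry 𝒜') (κ k c))
    forward every = Allₚ.map⁺ $ All.tabulate λ { {D , α , β} sq g d≡βg →
      to (ih α g) (every (α ⨾ g) (paste (commutes sq) d≡βg)) }
    backward : All (EveryFactorisation d) (map (shiftEntry 𝒜') (κ k c)) → EveryFactorisation (c ⨾ d) (_ , k , 𝒜')
    backward all g cd≡kg with represents k c g d (sym cd≡kg)
    ... | D , α , β , sq , γ , g≡αγ , d≡βγ =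
      subst (_⊨ 𝒜') (sym g≡αγ) (from (ih α γ) (All.lookup (Allₚ.map⁻ all) sq γ d≡βγ))

  shiftEntry-some : ∀ {A A' B C} (k : Hom A A') (𝒜' : Cond A') → ShiftProperty 𝒜' →
    (c : Hom A B) (d : Hom B C) →
    SomeFactorisation (c ⨾ d) (A' , k , 𝒜') ⇔ Any (SomeFactorisation d) (map (shiftEntry 𝒜') (κ k c))
  shiftEntry-some k 𝒜' ih c d = mk⇔ forward backward
    where
    forward : SomeFactorisation (c ⨾ d) (_ , k , 𝒜') → Any (SomeFactorisation d) (map (shiftEntry 𝒜') (κ k c))
    forward (g , cd≡kg , sat) with represents k c g d (sym cd≡kg)
    ... | D , α , β , sq , γ , g≡αγ , d≡βγ =
      Anyₚ.map⁺ (lose sq (γ , d≡βγ , to (ih α γ) (subst (_⊨ 𝒜') g≡αγ sat)))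
    backward : Any (SomeFactorisation d) (map (shiftEntry 𝒜') (κ k c)) → SomeFactorisation (c ⨾ d) (_ , k , 𝒜')
    backward some with find (Anyₚ.map⁻ some)
    ... | (D , α , β) , sq , g , d≡βg , sat = α ⨾ g , paste (commutes sq) d≡βg , from (ih α g) sat

  mutual
    shift-⇔ : ∀ {A} (𝒜 : Cond A) → ShiftProperty 𝒜
    shift-⇔ (cond ∀Q S) c d = mk⇔
      (from (⊨∀⇔All (shiftS S c)) ∘ to (shift-every S c d) ∘ to (⊨∀⇔All S))
      (from (⊨∀⇔All S) ∘ from (shift-every S c d) ∘ to (⊨∀⇔All (shiftS S c)))
    shift-⇔ (cond ∃Q S) c d = mk⇔
      (from (⊨∃⇔Any (shiftS S c)) ∘ to (shift-some S c d) ∘ to (⊨∃⇔Any S))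
      (from (⊨∃⇔Any S) ∘ from (shift-some S c d) ∘ to (⊨∃⇔Any (shiftS S c)))

    shift-every : ∀ {A B C} (S : List (Entry A)) (c : Hom A B) (d : Hom B C) →
      All (EveryFactorisation (c ⨾ d)) S ⇔ All (EveryFactorisation d) (shiftS S c)
    shift-every [] c d = mk⇔ (λ _ → []) (λ _ → [])
    shift-every ((A' , k , 𝒜') ∷ S) c d = mk⇔
      (λ { (p ∷ ps) → Allₚ.++⁺ (to head p) (to (shift-every S c d) ps) })
      (λ ps → let (p , q) = Allₚ.++⁻ (map (shiftEntry 𝒜') (κ k c)) ps
              in from head p ∷ from (shift-every S c d) q)
      where
      head : EveryFactorisation (c ⨾ d) (A' , k , 𝒜') ⇔ All (EveryFactorisation d) (map (shiftEntry 𝒜') (κ k c))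
      head = shiftEntry-every k 𝒜' (shift-⇔ 𝒜') c d

    shift-some : ∀ {A B C} (S : List (Entry A)) (c : Hom A B) (d : Hom B C) →
      Any (SomeFactorisation (c ⨾ d)) S ⇔ Any (SomeFactorisation d) (shiftS S c)
    shift-some [] c d = mk⇔ (λ ()) (λ ())
    shift-some ((A' , k , 𝒜') ∷ S) c d = mk⇔
      (λ { (here p) → Anyₚ.++⁺ˡ (to head p)
         ; (there q) → Anyₚ.++⁺ʳ (map (shiftEntry 𝒜') (κ k c)) (to (shift-some S c d) q) })
      ([ here ∘ from head , there ∘ from (shift-some S c d) ] ∘ Anyₚ.++⁻ (map (shiftEntry 𝒜') (κ k c)))
      where
      head : SomeFactorisation (c ⨾ d) (A' , k , 𝒜') ⇔ Any (SomeFactorisation d) (map (shiftEntry 𝒜') (κ k c))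
      head = shiftEntry-some k 𝒜' (shift-⇔ 𝒜') c d

  ↓-intro : ∀ {A B C} {𝒜 : Cond A} {c : Hom A B} {x : Hom B C} → (c ⨾ x) ⊨ 𝒜 → x ⊨ (𝒜 ↓ c)
  ↓-intro {𝒜 = 𝒜} {c} {x} = to (shift-⇔ 𝒜 c x)

  ↓-elim : ∀ {A B C} {𝒜 : Cond A} {c : Hom A B} {x : Hom B C} → x ⊨ (𝒜 ↓ c) → (c ⨾ x) ⊨ 𝒜
  ↓-elim {𝒜 = 𝒜} {c} {x} = from (shift-⇔ 𝒜 c x)

  ↓-transport : ∀ {A B B' C} {𝒜 : Cond A} {c : Hom A B} {c' : Hom A B'}
    {x : Hom B C} {y : Hom B' C} → c ⨾ x ≡ c' ⨾ y → x ⊨ (𝒜 ↓ c) → y ⊨ (𝒜 ↓ c')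
  ↓-transport {𝒜 = 𝒜} c⨾x≡c'⨾y =
    ↓-intro {𝒜 = 𝒜} ∘ subst (_⊨ 𝒜) c⨾x≡c'⨾y ∘ ↓-elim {𝒜 = 𝒜}

  ⊨C-↓ : ∀ {A B C} {𝒜 : Cond B} {ℛ : Cond A} {c : Hom A B} (γ : Hom B C) →
    𝒜 ⊨C (ℛ ↓ c) → (𝒜 ↓ γ) ⊨C (ℛ ↓ (c ⨾ γ))
  ⊨C-↓ {𝒜 = 𝒜} {ℛ} {c} γ 𝒜⊨ℛ x =
    ↓-transport {𝒜 = ℛ} (sym (assoc c γ x)) ∘ 𝒜⊨ℛ (γ ⨾ x) ∘ ↓-elim {𝒜 = 𝒜}

  contextStep-extend : ∀ {J J₁ K₀ K} {b : Hom 𝟎 J} {b₁ : Hom 𝟎 J₁} {f₀ : Hom J K₀} {f : Hom J₁ K}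
    {ℬ : Cond K₀} {b' : Hom 𝟎 K₀} (γ : Hom K₀ K) →
    ContextStep b f₀ ℬ b' → b₁ ⨾ f ≡ (b ⨾ f₀) ⨾ γ → ContextStep b₁ f (ℬ ↓ γ) (b' ⨾ γ)
  contextStep-extend {b = b} {b₁} {f₀} {f} {ℬ} γ (I , ℓ , r , ℛ , rule , c , bf₀≡ℓc , refl , ℬ⊨ℛ) b₁f≡bf₀γ =
    I , ℓ , r , ℛ , rule , c ⨾ γ , b₁f≡ℓcγ , assoc r c γ , ⊨C-↓ {𝒜 = ℬ} {ℛ} γ ℬ⊨ℛ
    where
    b₁f≡ℓcγ : b₁ ⨾ f ≡ ℓ ⨾ (c ⨾ γ)
    b₁f≡ℓcγ = begin
      b₁ ⨾ f          ≡⟨ b₁f≡bf₀γ ⟩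
      (b ⨾ f₀) ⨾ γ    ≡⟨ cong (_⨾ γ) bf₀≡ℓc ⟩
      (ℓ ⨾ c) ⨾ γ     ≡⟨ assoc ℓ c γ ⟩
      ℓ ⨾ (c ⨾ γ)     ∎
      where open ≡-Reasoning

  record Factorisation {J J' K} (a : Hom 𝟎 J) (d : Hom J J') (f : Hom J' K)
                       (𝒜 : Cond K) (a' : Hom 𝟎 K) : Set (o ⊔ h ⊔ ℓs) where
    field
      {K₀}      : Obj
      f₀        : Hom J K₀
      γ         : Hom K₀ K
      𝒜₀        : Cond K₀
      a₀'       : Hom 𝟎 K₀
      step      : RepStep a f₀ 𝒜₀ a₀'
      square    : d ⨾ f ≡ f₀ ⨾ γ
      target    : a' ≡ a₀' ⨾ γ
      condition : 𝒜 ⊨C (𝒜₀ ↓ γ)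

  -- Every representative step of a ⨾ d factors in this way: the square
  -- a ⨾ (d ⨾ f) = ℓ ⨾ c factors through a representative square (f₀ , c₀).
  repStep-factorise : ∀ {J J' K} {a : Hom 𝟎 J} {d : Hom J J'} {f : Hom J' K} {𝒜 : Cond K}
    {a' : Hom 𝟎 K} → RepStep (a ⨾ d) f 𝒜 a' → Factorisation a d f 𝒜 a'
  repStep-factorise {a = a} {d} {f} (I , ℓ , r , ℛ , rule , c , adf≡ℓc , refl , _ , _ , refl)
    with represents a ℓ (d ⨾ f) c (trans (sym (assoc a d f)) adf≡ℓc)
  ... | D , f₀ , c₀ , sq , γ , df≡f₀γ , c≡c₀γ = record
    { f₀        = f₀
    ; γ         = γ
    ; 𝒜₀        = ℛ ↓ c₀
    ; a₀'       = r ⨾ c₀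
    ; step      = I , ℓ , r , ℛ , rule , c₀ , commutes sq , refl , (λ _ sat → sat) , sq , refl
    ; square    = df≡f₀γ
    ; target    = trans (cong (r ⨾_) c≡c₀γ) (sym (assoc r c₀ γ))
    ; condition = λ x → ↓-intro {𝒜 = ℛ ↓ c₀}
                      ∘ ↓-transport {𝒜 = ℛ} (trans (cong (_⨾ x) c≡c₀γ) (assoc c₀ γ x))
    }

  whiskerˡ : ∀ {J J' K₀ K} (b : Hom 𝟎 J) {d : Hom J J'} {f : Hom J' K} {f₀ : Hom J K₀}
    {γ : Hom K₀ K} → d ⨾ f ≡ f₀ ⨾ γ → (b ⨾ d) ⨾ f ≡ (b ⨾ f₀) ⨾ γ
  whiskerˡ b {d} {f} {f₀} {γ} df≡f₀γ = begin
    (b ⨾ d) ⨾ f     ≡⟨ assoc b d f ⟩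
    b ⨾ (d ⨾ f)     ≡⟨ cong (b ⨾_) df≡f₀γ ⟩
    b ⨾ (f₀ ⨾ γ)    ≡⟨ sym (assoc b f₀ γ) ⟩
    (b ⨾ f₀) ⨾ γ    ∎
    where open ≡-Reasoning

  whiskerʳ : ∀ {J J' K₀ K M} {d : Hom J J'} {f : Hom J' K} {f₀ : Hom J K₀}
    {γ : Hom K₀ K} (x : Hom K M) → d ⨾ f ≡ f₀ ⨾ γ → d ⨾ (f ⨾ x) ≡ f₀ ⨾ (γ ⨾ x)
  whiskerʳ {d = d} {f} {f₀} {γ} x df≡f₀γ = begin
    d ⨾ (f ⨾ x)     ≡⟨ sym (assoc d f x) ⟩
    (d ⨾ f) ⨾ x     ≡⟨ cong (_⨾ x) df≡f₀γ ⟩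
    (f₀ ⨾ γ) ⨾ x    ≡⟨ assoc f₀ γ x ⟩
    f₀ ⨾ (γ ⨾ x)    ∎
    where open ≡-Reasoning

  answer-contextualise : (Q Q' : CondRel) →
    (∀ {J K} {a b : Hom 𝟎 J} {𝒞₀ : Cond J} (γ : Hom J K) → Q a b 𝒞₀ → Q' (a ⨾ γ) (b ⨾ γ) (𝒞₀ ↓ γ)) →
    ∀ {J K} {a b : Hom 𝟎 J} {𝒞₀ : Cond J} (d : Hom J K) →
    Answer Q a b 𝒞₀ → Answer Q' (a ⨾ d) (b ⨾ d) (𝒞₀ ↓ d)
  answer-contextualise Q Q' closed {b = b} {𝒞₀} d answer f 𝒜 a' repStep
    with repStep-factorise repStep
  ... | record { f₀ = f₀ ; γ = γ ; 𝒜₀ = 𝒜₀ ; a₀' = a₀' ; step = step ; square = square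
               ; target = refl ; condition = condition }
    with answer f₀ 𝒜₀ a₀' step
  ... | Ix , ℬ , b' , 𝒞' , steps , related , covered =
    Ix , (λ i → ℬ i ↓ γ) , (λ i → b' i ⨾ γ) , (λ i → 𝒞' i ↓ γ) ,
    (λ i → contextStep-extend {ℬ = ℬ i} γ (steps i) (whiskerˡ b square)) ,
    (λ i → closed γ (related i)) ,
    cover
    where
    cover : ∀ {M} (x : Hom _ M) → x ⊨ 𝒜 → x ⊨ ((𝒞₀ ↓ d) ↓ f) →
            Σ[ i ∈ Ix ] (x ⊨ (𝒞' i ↓ γ) × x ⊨ (ℬ i ↓ γ))
    cover x sat𝒜 sat𝒞 with covered (γ ⨾ x) (↓-elim {𝒜 = 𝒜₀} (condition x sat𝒜))
      (↓-transport {𝒜 = 𝒞₀} (whiskerʳ x square) (↓-elim {𝒜 = 𝒞₀ ↓ d} sat𝒞))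
    ... | i , sat𝒞' , satℬ = i , ↓-intro {𝒜 = 𝒞' i} sat𝒞' , ↓-intro {𝒜 = ℬ i} satℬ

  data Contextualised (R : CondRel) : CondRel where
    contextualise : ∀ {J K} {a b : Hom 𝟎 J} {𝒞₀ : Cond J} (d : Hom J K) →
      R a b 𝒞₀ → Contextualised R (a ⨾ d) (b ⨾ d) (𝒞₀ ↓ d)

  contextualised-isRepBisim : (R : CondRel) → IsRepBisim R → IsRepBisim (Contextualised R)
  contextualised-isRepBisim R isBisim _ _ _ (contextualise {a = a} {b} {𝒞₀} d related)
    with isBisim a b 𝒞₀ related
  ... | answerˡ , answerʳ =
    answer-contextualise R (Contextualised R) contextualise {𝒞₀ = 𝒞₀} d answerˡ ,
    answer-contextualise (flipRel R) (flipRel (Contextualised R)) contextualise {𝒞₀ = 𝒞₀} d answerʳ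

lemma4p16 : ∀ {o h ℓs} (𝒮 : CRS o h ℓs) →
    let open Theory 𝒮 in
    ∀ {J K} (a b : Hom 𝟎 J) (𝒞₀ : Cond J) → a ≃R b ∣ 𝒞₀ →
    (d : Hom J K) → (a ⨾ d) ≃R (b ⨾ d) ∣ (𝒞₀ ↓ d)
lemma4p16 𝒮 a b 𝒞₀ (R , isBisim , related) d =
  Contextualised R , contextualised-isRepBisim R isBisim , contextualise d related
  where open ContextualClosure 𝒮
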